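{- Let $G=(V,E,w)$ be a finite simple undirected graph with positive vertex weights containing a $4$-cycle $v_1v_2v_3v_4$ (edges $v_1v_2,v_2v_3,v_3v_4,v_4v_1$) such that $d_G(v_2)=d_G(v_3)=2$ and $w(v_1)\ge w(v_2)\ge w(v_3)$. Let $G'$ be the weighted graph obtained from $G$ by deleting $v_2$ and $v_3$ and changing the weight of $v_1$ to $w(v_1)+w(v_3)-w(v_2)$ (all other weights unchanged). Then $\alpha(G)=\alpha(G')+w(v_2)$.
   Context: $\alpha(H)$ denotes the maximum total vertex weight of an independent set in the weighted graph $H$; $d_G(v)$ is the degree of $v$ in $G$.
   Formalization: The positive vertex weights are taken to be rationals. -}

module Defs where

open import Data.Bool using (Bool; true; false; _∧_; _∨_; not; if_then_else_; T)
open import Data.Nat using (ℕ; zero; suc)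
open import Data.Fin using (Fin; _≟_)
open import Data.Vec using (Vec; []; _∷_; lookup; _[_]≔_)
open import Data.List using (List; []; _∷_; map; foldr; allFin; filterᵇ; length; _++_)
open import Data.Rational using (ℚ; 0ℚ; _+_; _-_; _⊔_)
open import Relation.Binary.PropositionalEquality using (_≡_)
open import Relation.Nullary using (¬_)
open import Relation.Nullary.Decidable using (⌊_⌋)

-- Vertices live in Fin n;
-- the actual vertex set is the Boolean subset V (so that vertex deletion is
-- just removal from V).  Adjacency is a symmetric irreflexive Boolean
-- relation; only adjacencies between vertices of V are meaningful.
record WGraph (n : ℕ) : Set where
  field
    V          : Vec Bool n
    adj        : Fin n → Fin n → Bool
    adj-sym    : ∀ u v → adj u v ≡ adj v u
    adj-irrefl : ∀ v → adj v v ≡ false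
    w          : Fin n → ℚ

open WGraph public

_∈V_ : ∀ {n} → Fin n → WGraph n → Set
v ∈V G = T (lookup (V G) v)

Edge : ∀ {n} → WGraph n → Fin n → Fin n → Set
Edge G u v = T (adj G u v)

deg : ∀ {n} → WGraph n → Fin n → ℕ
deg {n} G v = length (filterᵇ (λ u → lookup (V G) u ∧ adj G v u) (allFin n))

allSubsets : (n : ℕ) → List (Vec Bool n)
allSubsets zero    = [] ∷ []
allSubsets (suc n) = map (false ∷_) (allSubsets n) ++ map (true ∷_) (allSubsets n)

allᵇ : {A : Set} → (A → Bool) → List A → Bool
allᵇ p []       = true
allᵇ p (x ∷ xs) = p x ∧ allᵇ p xs

isIndep : ∀ {n} → WGraph n → Vec Bool n → Bool
isIndep {n} G S =
  allᵇ (λ i → not (lookup S i) ∨ lookup (V G) i) (allFin n) ∧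
  allᵇ (λ i → allᵇ (λ j → not (lookup S i ∧ lookup S j ∧ adj G i j)) (allFin n)) (allFin n)

weight : ∀ {n} → WGraph n → Vec Bool n → ℚ
weight {n} G S = foldr _+_ 0ℚ (map (λ i → if lookup S i then w G i else 0ℚ) (allFin n))

-- α(G): maximum total weight of an independent set of G (the empty set is
-- independent with weight 0, so the maximum starting from 0 is correct)
α : ∀ {n} → WGraph n → ℚ
α {n} G = foldr _⊔_ 0ℚ (map (λ S → if isIndep G S then weight G S else 0ℚ) (allSubsets n))

reduce : ∀ {n} → WGraph n → (v₁ v₂ v₃ : Fin n) → WGraph n
reduce G v₁ v₂ v₃ = record
  { V          = (V G [ v₂ ]≔ false) [ v₃ ]≔ false
  ; adj        = adj G
  ; adj-sym    = adj-sym G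
  ; adj-irrefl = adj-irrefl G
  ; w          = λ u → if ⌊ u ≟ v₁ ⌋ then w G v₁ + w G v₃ - w G v₂ else w G u
  }

{-# OPTIONS --safe #-}
-- Drop v₂ and v₃ from an independent set S of G. Since v₂v₃ is an edge, at most one of them is
-- in S, so at most w(v₂) is lost; if v₁ ∈ S then v₂ ∉ S, and the new weight w(v₁) + w(v₃) − w(v₂)
-- of v₁ turns a lost w(v₃) into a loss of exactly w(v₂). Conversely, an independent set of G′ is
-- extended by v₂ when it avoids v₁, and by v₃ when it contains v₁ (then it avoids v₄); as v₂ and
-- v₃ have degree two these are the only adjacencies to check, and in both cases the weight in G
-- is the weight in G′ plus w(v₂).
module Submission where

open import Defs
open import Data.Bool using (Bool; true; false; _∧_; _∨_; not; if_then_else_; T)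
open import Data.Bool.Properties using (T-≡)
open import Data.Empty using (⊥; ⊥-elim)
open import Data.Fin using (Fin; zero; suc; _≟_)
open import Data.List using ([]; _∷_; map; foldr; allFin; filterᵇ; length; _++_; tabulate)
open import Data.List.Properties using (map-tabulate)
open import Data.Fin.Properties using (suc-injective)
open import Data.List.Membership.Propositional using (_∈_)
open import Data.List.Membership.Propositional.Properties
  using (∈-map⁺; ∈-++⁺ˡ; ∈-++⁺ʳ; ∈-filter⁺; ∈-allFin; ∈-length)
open import Data.List.Relation.Unary.Any using (here; there; _─_)
open import Data.Nat as ℕ using (ℕ; zero; suc; s≤s)
open import Data.Product using (∃; _×_; _,_; proj₁; proj₂)
open import Data.Rational using (ℚ; 0ℚ; _+_; _-_; _≤_; _<_; _⊔_)
import Data.Rational.Properties as ℚ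
open import Data.Rational.Solver using (module +-*-Solver)
open import Data.Sum using (_⊎_; inj₁; inj₂)
open import Data.Vec using (Vec; []; _∷_; lookup; _[_]≔_; replicate)
open import Data.Vec.Properties using (lookup∘update; lookup∘update′; []≔-lookup; lookup-replicate)
open import Algebra.Properties.CommutativeMonoid.Sum ℚ.+-0-commutativeMonoid
  using (sum; sum-cong-≗; sum-replicate-zero)
open import Function using (_∘_; Equivalence)
open import Relation.Binary.PropositionalEquality
open import Relation.Nullary using (¬_; yes; no)
open import Relation.Nullary.Decidable using (isYes≗does; dec-true; dec-false; T?)

private
  variable
    n : ℕ
    A : Set

T⇒≡true : ∀ {b} → T b → b ≡ true
T⇒≡true = Equivalence.to T-≡

true≢false : ∀ {b} → b ≡ true → b ≡ false → ⊥
true≢false refl ()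

select : Bool → ℚ → ℚ
select b x = if b then x else 0ℚ

select-≤ : ∀ b {x y} → 0ℚ ≤ y → x ≤ y → select b x ≤ y
select-≤ true  _   x≤y = x≤y
select-≤ false 0≤y _   = 0≤y

sum-update : ∀ (k : Fin n) (f g : Fin n → ℚ) {c} →
  (∀ i → i ≢ k → f i ≡ g i) → f k ≡ g k + c → sum f ≡ sum g + c
sum-update {suc n} zero f g {c} off at = begin
  f zero + sum (f ∘ suc)       ≡⟨ cong₂ _+_ at (sum-cong-≗ (λ i → off (suc i) λ ())) ⟩
  (g zero + c) + sum (g ∘ suc) ≡⟨ solve 3 (λ x c s → (x :+ c) :+ s := (x :+ s) :+ c) refl (g zero) c _ ⟩
  (g zero + sum (g ∘ suc)) + c ∎
  where
  open ≡-Reasoning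
  open +-*-Solver
sum-update {suc n} (suc k) f g {c} off at = begin
  f zero + sum (f ∘ suc)       ≡⟨ cong₂ _+_ (off zero λ ()) (sum-update k (f ∘ suc) (g ∘ suc) off′ at) ⟩
  g zero + (sum (g ∘ suc) + c) ≡⟨ ℚ.+-assoc (g zero) _ c ⟨
  (g zero + sum (g ∘ suc)) + c ∎
  where
  open ≡-Reasoning
  off′ : ∀ i → i ≢ k → f (suc i) ≡ g (suc i)
  off′ i i≢k = off (suc i) (i≢k ∘ suc-injective)

foldr-+-tabulate : (h : Fin n → ℚ) → foldr _+_ 0ℚ (tabulate h) ≡ sum h
foldr-+-tabulate {zero}  h = refl
foldr-+-tabulate {suc n} h = cong (h zero +_) (foldr-+-tabulate (h ∘ suc))

weight≡sum : ∀ (G : WGraph n) S → weight G S ≡ sum (λ i → select (lookup S i) (w G i))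
weight≡sum {n} G S = trans (cong (foldr _+_ 0ℚ) (map-tabulate {n = n} (λ i → i) term)) (foldr-+-tabulate term)
  where
  term : Fin n → ℚ
  term i = select (lookup S i) (w G i)

weight-cong : ∀ (G H : WGraph n) S → (∀ i → lookup S i ≡ true → w G i ≡ w H i) →
  weight G S ≡ weight H S
weight-cong G H S agree = trans (weight≡sum G S) (trans (sum-cong-≗ term) (sym (weight≡sum H S)))
  where
  term : ∀ i → select (lookup S i) (w G i) ≡ select (lookup S i) (w H i)
  term i with lookup S i in Sᵢ
  ... | true  = agree i Sᵢ
  ... | false = refl

weight-∅ : ∀ (G : WGraph n) → weight G (replicate n false) ≡ 0ℚ
weight-∅ {n} G = trans (weight≡sum G (replicate n false))
  (trans (sum-cong-≗ (λ i → cong (λ b → select b (w G i)) (lookup-replicate i false)))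
         (sum-replicate-zero n))

weight-[]≔ : ∀ (G : WGraph n) S k b →
  weight G (S [ k ]≔ b) ≡ weight G (S [ k ]≔ false) + select b (w G k)
weight-[]≔ G S k b = begin
  weight G (S [ k ]≔ b)                       ≡⟨ weight≡sum G (S [ k ]≔ b) ⟩
  sum (term b)                                ≡⟨ sum-update k (term b) (term false) off at ⟩
  sum (term false) + select b (w G k)         ≡⟨ cong (_+ select b (w G k)) (weight≡sum G (S [ k ]≔ false)) ⟨
  weight G (S [ k ]≔ false) + select b (w G k) ∎
  where
  open ≡-Reasoning
  term : Bool → Fin _ → ℚ
  term b′ i = select (lookup (S [ k ]≔ b′) i) (w G i)
  off : ∀ i → i ≢ k → term b i ≡ term false i
  off i i≢k = cong (λ x → select x (w G i)) (trans (lookup∘update′ i≢k S b) (sym (lookup∘update′ i≢k S false)))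
  at : term b k ≡ term false k + select b (w G k)
  at rewrite lookup∘update k S b | lookup∘update k S false = sym (ℚ.+-identityˡ _)

[]≔-self : ∀ (S : Vec A n) k {x} → lookup S k ≡ x → S [ k ]≔ x ≡ S
[]≔-self S k Sₖ = trans (cong (S [ k ]≔_) (sym Sₖ)) ([]≔-lookup S k)

weight-remove : ∀ (G : WGraph n) S k {b} → lookup S k ≡ b →
  weight G S ≡ weight G (S [ k ]≔ false) + select b (w G k)
weight-remove G S k {b} Sₖ = trans (cong (weight G) (sym ([]≔-self S k Sₖ))) (weight-[]≔ G S k b)

weight-insert : ∀ (G : WGraph n) S k → lookup S k ≡ false →
  weight G (S [ k ]≔ true) ≡ weight G S + w G k
weight-insert G S k Sₖ = trans (weight-[]≔ G S k true) (cong (λ X → weight G X + w G k) ([]≔-self S k Sₖ))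

∧-elim : ∀ {a b} → a ∧ b ≡ true → a ≡ true × b ≡ true
∧-elim {true} b≡true = refl , b≡true

implies-sound : ∀ {a b} → not a ∨ b ≡ true → a ≡ true → b ≡ true
implies-sound {true} b≡true refl = b≡true

implies-complete : ∀ {a b} → (a ≡ true → b ≡ true) → not a ∨ b ≡ true
implies-complete {false} _ = refl
implies-complete {true}  h = h refl

nand₃-sound : ∀ {a b c} → not (a ∧ b ∧ c) ≡ true → a ≡ true → b ≡ true → c ≡ false
nand₃-sound {true} {true} {false} _ refl refl = refl

nand₃-complete : ∀ {a b c} → (a ≡ true → b ≡ true → c ≡ false) → not (a ∧ b ∧ c) ≡ true
nand₃-complete {false}         _ = refl
nand₃-complete {true} {false}  _ = refl
nand₃-complete {true} {true}   h rewrite h refl refl = refl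

allᵇ-sound : ∀ (p : A → Bool) {xs x} → allᵇ p xs ≡ true → x ∈ xs → p x ≡ true
allᵇ-sound p all (here refl) = proj₁ (∧-elim all)
allᵇ-sound p all (there x∈) = allᵇ-sound p (proj₂ (∧-elim all)) x∈

allᵇ-complete : ∀ (p : A → Bool) xs → (∀ {x} → x ∈ xs → p x ≡ true) → allᵇ p xs ≡ true
allᵇ-complete p []       _ = refl
allᵇ-complete p (x ∷ xs) h = cong₂ _∧_ (h (here refl)) (allᵇ-complete p xs (h ∘ there))

-- Relative to a vertex vector rather than a graph, so that deleting vertices is just updating that vector.
record Independent (Vs : Vec Bool n) (E : Fin n → Fin n → Bool) (S : Vec Bool n) : Set where
  field
    ⊆V      : ∀ i → lookup S i ≡ true → lookup Vs i ≡ true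
    no-edge : ∀ i j → lookup S i ≡ true → lookup S j ≡ true → E i j ≡ false

open Independent

isIndep-sound : ∀ (G : WGraph n) S → isIndep G S ≡ true → Independent (V G) (adj G) S
isIndep-sound G S indep = record
  { ⊆V      = λ i → implies-sound (allᵇ-sound _ vertices (∈-allFin i))
  ; no-edge = λ i j → nand₃-sound (allᵇ-sound _ (allᵇ-sound _ edges (∈-allFin i)) (∈-allFin j))
  }
  where
  vertices = proj₁ (∧-elim indep)
  edges    = proj₂ (∧-elim indep)

isIndep-complete : ∀ (G : WGraph n) S → Independent (V G) (adj G) S → isIndep G S ≡ true
isIndep-complete {n} G S ind = cong₂ _∧_
  (allᵇ-complete _ (allFin n) (λ {i} _ → implies-complete (⊆V ind i)))
  (allᵇ-complete _ (allFin n) (λ {i} _ → allᵇ-complete _ (allFin n) (λ {j} _ → nand₃-complete (no-edge ind i j))))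

Independent-∅ : ∀ {Vs E} → Independent {n} Vs E (replicate n false)
Independent-∅ = record
  { ⊆V      = λ i ∅ᵢ → ⊥-elim (true≢false ∅ᵢ (lookup-replicate i false))
  ; no-edge = λ i _ ∅ᵢ _ → ⊥-elim (true≢false ∅ᵢ (lookup-replicate i false))
  }

Independent-mono : ∀ {Vs Ws E} {S : Vec Bool n} → (∀ i → lookup Vs i ≡ true → lookup Ws i ≡ true) →
  Independent Vs E S → Independent Ws E S
Independent-mono Vs⊆Ws ind = record { ⊆V = λ i → Vs⊆Ws i ∘ ⊆V ind i ; no-edge = no-edge ind }

Independent-outside : ∀ {Vs E} {S : Vec Bool n} → Independent Vs E S →
  ∀ {i} → lookup Vs i ≡ false → lookup S i ≡ false
Independent-outside {S = S} ind {i} Vsᵢ with lookup S i in Sᵢ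
... | false = refl
... | true  = ⊥-elim (true≢false (⊆V ind i Sᵢ) Vsᵢ)

Independent-excludes : ∀ {Vs E} {S : Vec Bool n} → Independent Vs E S →
  ∀ {i j} → E i j ≡ true → lookup S i ≡ true → lookup S j ≡ false
Independent-excludes {S = S} ind {i} {j} Eᵢⱼ Sᵢ with lookup S j in Sⱼ
... | false = refl
... | true  = ⊥-elim (true≢false Eᵢⱼ (no-edge ind i j Sᵢ Sⱼ))

[]≔false-member : ∀ (X : Vec Bool n) k i → lookup (X [ k ]≔ false) i ≡ true → i ≢ k × lookup X i ≡ true
[]≔false-member X k i Xᵢ with i ≟ k
... | yes refl = ⊥-elim (true≢false Xᵢ (lookup∘update k X false))
... | no  i≢k  = i≢k , trans (sym (lookup∘update′ i≢k X false)) Xᵢ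

Independent-delete : ∀ {Vs E} {S : Vec Bool n} → Independent Vs E S →
  ∀ k → Independent (Vs [ k ]≔ false) E (S [ k ]≔ false)
Independent-delete {Vs = Vs} {S = S} ind k = record
  { ⊆V      = λ i Sᵢ → let i≢k , Sᵢ′ = []≔false-member S k i Sᵢ in
                       trans (lookup∘update′ i≢k Vs false) (⊆V ind i Sᵢ′)
  ; no-edge = λ i j Sᵢ Sⱼ → no-edge ind i j (proj₂ ([]≔false-member S k i Sᵢ)) (proj₂ ([]≔false-member S k j Sⱼ))
  }

Independent-insert : ∀ (G : WGraph n) {S u} → Independent (V G) (adj G) S → lookup (V G) u ≡ true →
  (∀ j → lookup S j ≡ true → adj G u j ≡ false) → Independent (V G) (adj G) (S [ u ]≔ true)
Independent-insert G {S} {u} ind Vᵤ free = record { ⊆V = ⊆V′ ; no-edge = no-edge′ }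
  where
  member : ∀ {i} → lookup (S [ u ]≔ true) i ≡ true → i ≡ u ⊎ lookup S i ≡ true
  member {i} Sᵢ with i ≟ u
  ... | yes i≡u = inj₁ i≡u
  ... | no  i≢u = inj₂ (trans (sym (lookup∘update′ i≢u S true)) Sᵢ)
  ⊆V′ : ∀ i → lookup (S [ u ]≔ true) i ≡ true → lookup (V G) i ≡ true
  ⊆V′ i Sᵢ with member Sᵢ
  ... | inj₁ refl = Vᵤ
  ... | inj₂ Sᵢ′  = ⊆V ind i Sᵢ′
  no-edge′ : ∀ i j → lookup (S [ u ]≔ true) i ≡ true → lookup (S [ u ]≔ true) j ≡ true → adj G i j ≡ false
  no-edge′ i j Sᵢ Sⱼ with member Sᵢ | member Sⱼ
  ... | inj₁ refl | inj₁ refl = adj-irrefl G i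
  ... | inj₁ refl | inj₂ Sⱼ′  = free j Sⱼ′
  ... | inj₂ Sᵢ′  | inj₁ refl = trans (adj-sym G i j) (free i Sᵢ′)
  ... | inj₂ Sᵢ′  | inj₂ Sⱼ′  = no-edge ind i j Sᵢ′ Sⱼ′

∈-allSubsets : (S : Vec Bool n) → S ∈ allSubsets n
∈-allSubsets []          = here refl
∈-allSubsets {suc n} (false ∷ S) = ∈-++⁺ˡ (∈-map⁺ (false ∷_) (∈-allSubsets S))
∈-allSubsets {suc n} (true ∷ S)  = ∈-++⁺ʳ (map (false ∷_) (allSubsets n)) (∈-map⁺ (true ∷_) (∈-allSubsets S))

foldr-⊔-upper : ∀ (f : A → ℚ) {x xs} → x ∈ xs → f x ≤ foldr _⊔_ 0ℚ (map f xs)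
foldr-⊔-upper f (here refl)         = ℚ.p≤p⊔q (f _) _
foldr-⊔-upper f {xs = y ∷ _} (there x∈) = ℚ.p≤q⇒p≤r⊔q (f y) (foldr-⊔-upper f x∈)

foldr-⊔-attained : ∀ (f : A → ℚ) xs →
  foldr _⊔_ 0ℚ (map f xs) ≡ 0ℚ ⊎ ∃ λ x → x ∈ xs × foldr _⊔_ 0ℚ (map f xs) ≡ f x
foldr-⊔-attained f []       = inj₁ refl
foldr-⊔-attained f (y ∷ xs) with ℚ.⊔-sel (f y) (foldr _⊔_ 0ℚ (map f xs))
... | inj₁ max≡y = inj₂ (y , here refl , max≡y)
... | inj₂ max≡rest with foldr-⊔-attained f xs
...   | inj₁ rest≡0             = inj₁ (trans max≡rest rest≡0)
...   | inj₂ (x , x∈ , rest≡x) = inj₂ (x , there x∈ , trans max≡rest rest≡x)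

candidate : WGraph n → Vec Bool n → ℚ
candidate G X = if isIndep G X then weight G X else 0ℚ

α-upper : ∀ (G : WGraph n) {S} → Independent (V G) (adj G) S → weight G S ≤ α G
α-upper {n} G {S} ind
  with foldr-⊔-upper (candidate G) (∈-allSubsets S)
... | bound rewrite isIndep-complete G S ind = bound

α-attained : ∀ (G : WGraph n) → ∃ λ S → Independent (V G) (adj G) S × α G ≡ weight G S
α-attained {n} G with foldr-⊔-attained (candidate G) (allSubsets n)
... | inj₁ α≡0 = replicate n false , Independent-∅ , trans α≡0 (sym (weight-∅ G))
... | inj₂ (S , _ , α≡) with isIndep G S in indep
...   | true  = S , isIndep-sound G S indep , α≡
...   | false = replicate n false , Independent-∅ , trans α≡ (sym (weight-∅ G))

length-─ : ∀ {x : A} {xs} (x∈ : x ∈ xs) → length xs ≡ suc (length (xs ─ x∈))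
length-─ (here _)   = refl
length-─ (there x∈) = cong suc (length-─ x∈)

∈-─ : ∀ {x y : A} {xs} (y∈ : y ∈ xs) → x ∈ xs → x ≢ y → x ∈ (xs ─ y∈)
∈-─ (here refl) (here refl) x≢y = ⊥-elim (x≢y refl)
∈-─ (here refl) (there x∈)  _   = x∈
∈-─ (there y∈)  (here refl) _   = here refl
∈-─ (there y∈)  (there x∈)  x≢y = there (∈-─ y∈ x∈ x≢y)

3≤length : ∀ {a b c : A} {xs} → a ≢ b → a ≢ c → b ≢ c → a ∈ xs → b ∈ xs → c ∈ xs → 3 ℕ.≤ length xs
3≤length a≢b a≢c b≢c a∈ b∈ c∈ =
  subst (3 ℕ.≤_) (sym (trans (length-─ a∈) (cong suc (length-─ b∈′)))) (s≤s (s≤s (∈-length c∈″)))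
  where
  b∈′ = ∈-─ a∈ b∈ (a≢b ∘ sym)
  c∈″ = ∈-─ b∈′ (∈-─ a∈ c∈ (a≢c ∘ sym)) (b≢c ∘ sym)

Neighbour : WGraph n → Fin n → Fin n → Set
Neighbour G v u = lookup (V G) u ∧ adj G v u ≡ true

deg≡2-neighbours : ∀ (G : WGraph n) {v a b j} → deg G v ≡ 2 → a ≢ b →
  Neighbour G v a → Neighbour G v b → Neighbour G v j → j ≡ a ⊎ j ≡ b
deg≡2-neighbours {n} G {v} {a} {b} {j} deg≡2 a≢b Na Nb Nⱼ with j ≟ a | j ≟ b
... | yes j≡a | _       = inj₁ j≡a
... | no _    | yes j≡b = inj₂ j≡b
... | no j≢a  | no j≢b  = ⊥-elim (3≰2 (subst (3 ℕ.≤_) deg≡2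
      (3≤length a≢b (j≢a ∘ sym) (j≢b ∘ sym) (member Na) (member Nb) (member Nⱼ))))
  where
  member : ∀ {u} → Neighbour G v u → u ∈ filterᵇ (λ u → lookup (V G) u ∧ adj G v u) (allFin n)
  member Nᵤ = ∈-filter⁺ (T? ∘ _) (∈-allFin _) (Equivalence.from T-≡ Nᵤ)
  3≰2 : ¬ 3 ℕ.≤ 2
  3≰2 (s≤s (s≤s ()))

Independent-insert-deg≡2 : ∀ (G : WGraph n) {S v a b} → Independent (V G) (adj G) S →
  lookup (V G) v ≡ true → deg G v ≡ 2 → a ≢ b → Neighbour G v a → Neighbour G v b →
  lookup S a ≡ false → lookup S b ≡ false → Independent (V G) (adj G) (S [ v ]≔ true)
Independent-insert-deg≡2 G {S} {v} ind Vᵥ deg≡2 a≢b Na Nb Sa Sb = Independent-insert G ind Vᵥ free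
  where
  free : ∀ j → lookup S j ≡ true → adj G v j ≡ false
  free j Sⱼ with adj G v j in vj
  ... | false = refl
  ... | true with deg≡2-neighbours G deg≡2 a≢b Na Nb (cong₂ _∧_ (⊆V ind j Sⱼ) vj)
  ...   | inj₁ refl = ⊥-elim (true≢false Sⱼ Sa)
  ...   | inj₂ refl = ⊥-elim (true≢false Sⱼ Sb)

module FourCycle {n} (G : WGraph n) (v₁ v₂ v₃ v₄ : Fin n)
  (V₁ : lookup (V G) v₁ ≡ true) (V₂ : lookup (V G) v₂ ≡ true)
  (V₃ : lookup (V G) v₃ ≡ true) (V₄ : lookup (V G) v₄ ≡ true)
  (v₁≢v₂ : v₁ ≢ v₂) (v₁≢v₃ : v₁ ≢ v₃) (v₂≢v₃ : v₂ ≢ v₃) (v₂≢v₄ : v₂ ≢ v₄)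
  (e₁₂ : adj G v₁ v₂ ≡ true) (e₂₃ : adj G v₂ v₃ ≡ true)
  (e₃₄ : adj G v₃ v₄ ≡ true) (e₄₁ : adj G v₄ v₁ ≡ true)
  (deg₂ : deg G v₂ ≡ 2) (deg₃ : deg G v₃ ≡ 2)
  (0≤w₂ : 0ℚ ≤ w G v₂) (0≤w₃ : 0ℚ ≤ w G v₃) (w₃≤w₂ : w G v₃ ≤ w G v₂)
  where

  G′ : WGraph n
  G′ = reduce G v₁ v₂ v₃

  w₁ w₂ w₃ : ℚ
  w₁ = w G v₁
  w₂ = w G v₂
  w₃ = w G v₃

  delete₂₃ : Vec Bool n → Vec Bool n
  delete₂₃ X = (X [ v₂ ]≔ false) [ v₃ ]≔ false

  lookup-delete₂₃ : ∀ X {i} → i ≢ v₂ → i ≢ v₃ → lookup (delete₂₃ X) i ≡ lookup X i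
  lookup-delete₂₃ X i≢v₂ i≢v₃ = trans (lookup∘update′ i≢v₃ (X [ v₂ ]≔ false) false) (lookup∘update′ i≢v₂ X false)

  delete₂₃-v₂ : ∀ X → lookup (delete₂₃ X) v₂ ≡ false
  delete₂₃-v₂ X = trans (lookup∘update′ v₂≢v₃ (X [ v₂ ]≔ false) false) (lookup∘update v₂ X false)

  delete₂₃-v₃ : ∀ X → lookup (delete₂₃ X) v₃ ≡ false
  delete₂₃-v₃ X = lookup∘update v₃ (X [ v₂ ]≔ false) false

  delete₂₃-⊆ : ∀ X i → lookup (delete₂₃ X) i ≡ true → lookup X i ≡ true
  delete₂₃-⊆ X i Xᵢ = proj₂ ([]≔false-member X v₂ i (proj₂ ([]≔false-member (X [ v₂ ]≔ false) v₃ i Xᵢ)))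

  Independent-delete₂₃ : ∀ {S} → Independent (V G) (adj G) S → Independent (V G′) (adj G′) (delete₂₃ S)
  Independent-delete₂₃ ind = Independent-delete (Independent-delete ind v₂) v₃

  w′-v₁ : w G′ v₁ ≡ w₁ + w₃ - w₂
  w′-v₁ = cong (λ b → if b then w₁ + w₃ - w₂ else w₁)
    (trans (isYes≗does (v₁ ≟ v₁)) (dec-true (v₁ ≟ v₁) refl))

  w′-other : ∀ {i} → i ≢ v₁ → w G′ i ≡ w G i
  w′-other {i} i≢v₁ = cong (λ b → if b then w₁ + w₃ - w₂ else w G i)
    (trans (isYes≗does (i ≟ v₁)) (dec-false (i ≟ v₁) i≢v₁))

  weight-reduce-∉ : ∀ X → lookup X v₁ ≡ false → weight G′ X ≡ weight G X
  weight-reduce-∉ X X₁ = weight-cong G′ G X (λ i Xᵢ → w′-other λ { refl → true≢false Xᵢ X₁ })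

  weight-reduce-∈ : ∀ X → lookup X v₁ ≡ true → weight G′ X + w₂ ≡ weight G X + w₃
  weight-reduce-∈ X X₁ = begin
    weight G′ X + w₂                      ≡⟨ cong (_+ w₂) (weight-remove G′ X v₁ X₁) ⟩
    (weight G′ X₀ + w G′ v₁) + w₂         ≡⟨ cong₂ (λ a b → (a + b) + w₂) (weight-reduce-∉ X₀ (lookup∘update v₁ X false)) w′-v₁ ⟩
    (weight G X₀ + (w₁ + w₃ - w₂)) + w₂   ≡⟨ solve 4 (λ K a b c → (K :+ ((a :+ c) :- b)) :+ b := (K :+ a) :+ c) refl (weight G X₀) w₁ w₂ w₃ ⟩
    (weight G X₀ + w₁) + w₃               ≡⟨ cong (_+ w₃) (weight-remove G X v₁ X₁) ⟨
    weight G X + w₃                       ∎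
    where
    open ≡-Reasoning
    open +-*-Solver
    X₀ = X [ v₁ ]≔ false

  lost : Vec Bool n → ℚ
  lost S = select (lookup S v₃) w₃ + select (lookup S v₂) w₂

  weight-delete₂₃ : ∀ S → weight G S ≡ weight G (delete₂₃ S) + lost S
  weight-delete₂₃ S = begin
    weight G S                                                  ≡⟨ weight-remove G S v₂ refl ⟩
    weight G (S [ v₂ ]≔ false) + select (lookup S v₂) w₂        ≡⟨ cong (_+ select (lookup S v₂) w₂) (weight-remove G (S [ v₂ ]≔ false) v₃ S₃) ⟩
    (weight G (delete₂₃ S) + select (lookup S v₃) w₃) + select (lookup S v₂) w₂ ≡⟨ ℚ.+-assoc (weight G (delete₂₃ S)) _ _ ⟩
    weight G (delete₂₃ S) + lost S                              ∎
    where
    open ≡-Reasoning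
    S₃ = lookup∘update′ (v₂≢v₃ ∘ sym) S false

  lost≤w₂ : ∀ {S} → Independent (V G) (adj G) S → lost S ≤ w₂
  lost≤w₂ {S} ind with lookup S v₂ in S₂
  ... | false = ℚ.≤-trans (ℚ.≤-reflexive (ℚ.+-identityʳ _)) (select-≤ (lookup S v₃) 0≤w₂ w₃≤w₂)
  ... | true rewrite Independent-excludes ind e₂₃ S₂ = ℚ.≤-reflexive (ℚ.+-identityˡ w₂)

  lost≤w₃ : ∀ {S} → Independent (V G) (adj G) S → lookup S v₁ ≡ true → lost S ≤ w₃
  lost≤w₃ {S} ind S₁ rewrite Independent-excludes ind e₁₂ S₁ =
    ℚ.≤-trans (ℚ.≤-reflexive (ℚ.+-identityʳ _)) (select-≤ (lookup S v₃) 0≤w₃ ℚ.≤-refl)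

  weight≤weight′+w₂ : ∀ {S} → Independent (V G) (adj G) S → weight G S ≤ weight G′ (delete₂₃ S) + w₂
  weight≤weight′+w₂ {S} ind with lookup S v₁ in S₁
  ... | true = begin
    weight G S          ≡⟨ weight-delete₂₃ S ⟩
    weight G S⁻ + lost S ≤⟨ ℚ.+-monoʳ-≤ (weight G S⁻) (lost≤w₃ ind S₁) ⟩
    weight G S⁻ + w₃     ≡⟨ weight-reduce-∈ S⁻ (trans (lookup-delete₂₃ S v₁≢v₂ v₁≢v₃) S₁) ⟨
    weight G′ S⁻ + w₂    ∎
    where
    open ℚ.≤-Reasoning
    S⁻ = delete₂₃ S
  ... | false = begin
    weight G S          ≡⟨ weight-delete₂₃ S ⟩
    weight G S⁻ + lost S ≤⟨ ℚ.+-monoʳ-≤ (weight G S⁻) (lost≤w₂ ind) ⟩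
    weight G S⁻ + w₂     ≡⟨ cong (_+ w₂) (weight-reduce-∉ S⁻ (trans (lookup-delete₂₃ S v₁≢v₂ v₁≢v₃) S₁)) ⟨
    weight G′ S⁻ + w₂    ∎
    where
    open ℚ.≤-Reasoning
    S⁻ = delete₂₃ S

  Independent-G : ∀ {S′} → Independent (V G′) (adj G′) S′ → Independent (V G) (adj G) S′
  Independent-G = Independent-mono (delete₂₃-⊆ (V G))

  insert-v₂ : ∀ {S′} → Independent (V G′) (adj G′) S′ → lookup S′ v₁ ≡ false → weight G′ S′ + w₂ ≤ α G
  insert-v₂ {S′} ind S′₁ = begin
    weight G′ S′ + w₂          ≡⟨ cong (_+ w₂) (weight-reduce-∉ S′ S′₁) ⟩
    weight G S′ + w₂           ≡⟨ weight-insert G S′ v₂ S′₂ ⟨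
    weight G (S′ [ v₂ ]≔ true) ≤⟨ α-upper G (Independent-insert-deg≡2 G (Independent-G ind) V₂ deg₂ v₁≢v₃ N₂₁ N₂₃ S′₁ S′₃) ⟩
    α G                       ∎
    where
    open ℚ.≤-Reasoning
    S′₂ = Independent-outside ind (delete₂₃-v₂ (V G))
    S′₃ = Independent-outside ind (delete₂₃-v₃ (V G))
    N₂₁ : Neighbour G v₂ v₁
    N₂₁ = cong₂ _∧_ V₁ (trans (adj-sym G v₂ v₁) e₁₂)
    N₂₃ : Neighbour G v₂ v₃
    N₂₃ = cong₂ _∧_ V₃ e₂₃

  insert-v₃ : ∀ {S′} → Independent (V G′) (adj G′) S′ → lookup S′ v₁ ≡ true → weight G′ S′ + w₂ ≤ α G
  insert-v₃ {S′} ind S′₁ = begin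
    weight G′ S′ + w₂          ≡⟨ weight-reduce-∈ S′ S′₁ ⟩
    weight G S′ + w₃           ≡⟨ weight-insert G S′ v₃ S′₃ ⟨
    weight G (S′ [ v₃ ]≔ true) ≤⟨ α-upper G (Independent-insert-deg≡2 G (Independent-G ind) V₃ deg₃ v₂≢v₄ N₃₂ N₃₄ S′₂ S′₄) ⟩
    α G                       ∎
    where
    open ℚ.≤-Reasoning
    S′₂ = Independent-outside ind (delete₂₃-v₂ (V G))
    S′₃ = Independent-outside ind (delete₂₃-v₃ (V G))
    S′₄ = Independent-excludes ind (trans (adj-sym G v₁ v₄) e₄₁) S′₁
    N₃₂ : Neighbour G v₃ v₂
    N₃₂ = cong₂ _∧_ V₂ (trans (adj-sym G v₃ v₂) e₂₃)
    N₃₄ : Neighbour G v₃ v₄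
    N₃₄ = cong₂ _∧_ V₄ e₃₄

  weight′+w₂≤α : ∀ {S′} → Independent (V G′) (adj G′) S′ → weight G′ S′ + w₂ ≤ α G
  weight′+w₂≤α {S′} ind with lookup S′ v₁ in S′₁
  ... | false = insert-v₂ ind S′₁
  ... | true  = insert-v₃ ind S′₁

  α-reduce : α G ≡ α G′ + w₂
  α-reduce = ℚ.≤-antisym upper lower
    where
    upper : α G ≤ α G′ + w₂
    upper with α-attained G
    ... | S , ind , α≡ = begin
      α G                          ≡⟨ α≡ ⟩
      weight G S                   ≤⟨ weight≤weight′+w₂ ind ⟩
      weight G′ (delete₂₃ S) + w₂  ≤⟨ ℚ.+-monoˡ-≤ w₂ (α-upper G′ (Independent-delete₂₃ ind)) ⟩
      α G′ + w₂                    ∎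
      where open ℚ.≤-Reasoning
    lower : α G′ + w₂ ≤ α G
    lower with α-attained G′
    ... | S′ , ind , α≡ = subst (λ a → a + w₂ ≤ α G) (sym α≡) (weight′+w₂≤α ind)

lemma5 : ∀ {n} (G : WGraph n) (v₁ v₂ v₃ v₄ : Fin n) →
    (∀ v → v ∈V G → 0ℚ < w G v) →
    v₁ ∈V G → v₂ ∈V G → v₃ ∈V G → v₄ ∈V G →
    v₁ ≢ v₂ → v₁ ≢ v₃ → v₁ ≢ v₄ → v₂ ≢ v₃ → v₂ ≢ v₄ → v₃ ≢ v₄ →
    Edge G v₁ v₂ → Edge G v₂ v₃ → Edge G v₃ v₄ → Edge G v₄ v₁ →
    deg G v₂ ≡ 2 → deg G v₃ ≡ 2 →
    w G v₂ ≤ w G v₁ → w G v₃ ≤ w G v₂ →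
    α G ≡ α (reduce G v₁ v₂ v₃) + w G v₂
lemma5 G v₁ v₂ v₃ v₄ pos v₁∈ v₂∈ v₃∈ v₄∈ v₁≢v₂ v₁≢v₃ _ v₂≢v₃ v₂≢v₄ _ e₁₂ e₂₃ e₃₄ e₄₁ deg₂ deg₃ _ w₃≤w₂ =
  FourCycle.α-reduce G v₁ v₂ v₃ v₄
    (T⇒≡true v₁∈) (T⇒≡true v₂∈) (T⇒≡true v₃∈) (T⇒≡true v₄∈)
    v₁≢v₂ v₁≢v₃ v₂≢v₃ v₂≢v₄
    (T⇒≡true e₁₂) (T⇒≡true e₂₃) (T⇒≡true e₃₄) (T⇒≡true e₄₁)
    deg₂ deg₃ (ℚ.<⇒≤ (pos v₂ v₂∈)) (ℚ.<⇒≤ (pos v₃ v₃∈)) w₃≤w₂
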